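{- Let $(\delta,K_1,K_2,C_0,C_1)$ be admissible parameters satisfying Case IIB. Let $\mathbf C$ be a cycle with distances $d_0,d_1,d_2,x_1,\dots,x_k$ such that either $\mathbf C$ has even perimeter and $d_0+d_1+d_2>(C_0-1)+\sum_{i=1}^kx_i$, or $\mathbf C$ has odd perimeter and $d_0+d_1+d_2>(C_1-1)+\sum_{i=1}^kx_i$. Then $d_i\ge K_2$ for every $i\in\{0,1,2\}$ and $\sum_{i=1}^kx_i\le\delta-K_2<K_1$.
   Context: A $\delta$-edge-labelled cycle is a cycle graph (at least 3 vertices) with edge labels in $\{1,\dots,\delta\}$; it "has distances $d_1,\dots,d_m$" if its edges can be listed in some (arbitrary) order with these labels; its perimeter is the sum of labels. Parameters: integers with $3\le\delta<\infty$, $1\le K_1\le K_2\le\delta$, $2\delta+2\le C_0,C_1\le3\delta+2$, $C_0$ even, $C_1$ odd; $C=\min(C_0,C_1)$, $C'=\max(C_0,C_1)$. Case IIB (admissible) means: $C\le2\delta+K_1$, $C=2K_1+2K_2+1$, $K_1+K_2\ge\delta$, $K_1+2K_2\le2\delta-1$, $C'>C+1$, $K_1=K_2$ and $3K_2=2\delta-1$. -}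

module Defs where

open import Data.Nat using (ℕ; _+_; _*_; _∸_; _≤_; _<_; _⊓_; _⊔_; _%_)
open import Data.List using (List; length; _∷_)
open import Data.Nat.ListAction using (sum)
open import Data.List.Relation.Unary.All using (All)
open import Data.List.Relation.Binary.Permutation.Propositional using (_↭_)
open import Data.Product using (_×_)
open import Relation.Binary.PropositionalEquality using (_≡_)

-- A δ-edge-labelled cycle, recorded by the cyclic sequence of its edge labels
-- (edge i joins vertex i and vertex i+1 mod n, n = number of vertices = number of edges).
record LabelledCycle (δ : ℕ) : Set where
  field
    labels    : List ℕ
    atLeast3  : 3 ≤ length labels
    inRange   : All (λ d → 1 ≤ d × d ≤ δ) labels
open LabelledCycle public

HasDistances : ∀ {δ} → LabelledCycle δ → List ℕ → Set
HasDistances c ds = labels c ↭ ds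

perimeter : ∀ {δ} → LabelledCycle δ → ℕ
perimeter c = sum (labels c)

Even Odd : ℕ → Set
Even n = n % 2 ≡ 0
Odd  n = n % 2 ≡ 1

record Admissible (δ K₁ K₂ C₀ C₁ : ℕ) : Set where
  field
    δ≥3    : 3 ≤ δ
    K₁≥1   : 1 ≤ K₁
    K₁≤K₂  : K₁ ≤ K₂
    K₂≤δ   : K₂ ≤ δ
    C₀-lo  : 2 * δ + 2 ≤ C₀
    C₀-hi  : C₀ ≤ 3 * δ + 2
    C₁-lo  : 2 * δ + 2 ≤ C₁
    C₁-hi  : C₁ ≤ 3 * δ + 2
    C₀-even : Even C₀
    C₁-odd  : Odd C₁

record CaseIIB (δ K₁ K₂ C₀ C₁ : ℕ) : Set where
  field
    c1 : C₀ ⊓ C₁ ≤ 2 * δ + K₁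
    c2 : C₀ ⊓ C₁ ≡ 2 * K₁ + 2 * K₂ + 1
    c3 : δ ≤ K₁ + K₂
    c4 : K₁ + 2 * K₂ + 1 ≤ 2 * δ
    c5 : (C₀ ⊓ C₁) + 1 < C₀ ⊔ C₁
    c6 : K₁ ≡ K₂
    c7 : 3 * K₂ + 1 ≡ 2 * δ

-- With K₁ = K₂ = K, the parameters satisfy 2δ = 3K + 1 and C₀ ⊓ C₁ = 4K + 1, so either
-- perimeter condition yields d₀ + d₁ + d₂ > 4K + Σxᵢ. As the two other distances are at
-- most δ each, every dᵢ exceeds 4K + Σxᵢ − 2δ = K + Σxᵢ − 1; hence dᵢ ≥ K + Σxᵢ, and
-- dᵢ ≤ δ gives Σxᵢ ≤ δ − K. Finally δ − K < K amounts to 2δ < 4K, i.e. K ≥ 2, which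
-- follows from 3K + 1 = 2δ ≥ 6.
module Submission where

open import Defs
open import Data.Nat using (ℕ; _+_; _*_; _∸_; _≤_; _<_; _>_; _⊓_; suc; s≤s; z≤n; s≤s⁻¹; z<s; >-nonZero)
open import Data.Nat.Properties
open import Data.Nat.Tactic.RingSolver using (solve-∀)
open import Data.List using (List; _∷_)
open import Data.List.Relation.Unary.All using (_∷_)
open import Data.List.Relation.Binary.Permutation.Propositional.Properties using (All-resp-↭)
open import Data.Nat.ListAction using (sum)
open import Data.Product using (_×_; _,_)
open import Data.Sum using (_⊎_; inj₁; inj₂)
open import Relation.Binary.PropositionalEquality using (_≡_; sym; trans; cong; subst)

HasDistances⇒first-three-≤ : ∀ {δ} (c : LabelledCycle δ) {d₀ d₁ d₂ xs} →
  HasDistances c (d₀ ∷ d₁ ∷ d₂ ∷ xs) → d₀ ≤ δ × d₁ ≤ δ × d₂ ≤ δ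
HasDistances⇒first-three-≤ c p with All-resp-↭ p (inRange c)
... | (_ , d₀≤δ) ∷ (_ , d₁≤δ) ∷ (_ , d₂≤δ) ∷ _ = d₀≤δ , d₁≤δ , d₂≤δ

⊎-threshold⇒⊓-threshold : ∀ {A B : Set} C₀ C₁ S D →
  (A × C₀ ∸ 1 + S < D) ⊎ (B × C₁ ∸ 1 + S < D) → (C₀ ⊓ C₁) ∸ 1 + S < D
⊎-threshold⇒⊓-threshold C₀ C₁ S D (inj₁ (_ , lt)) = ≤-<-trans (+-monoˡ-≤ S (∸-monoˡ-≤ 1 (m⊓n≤m C₀ C₁))) lt
⊎-threshold⇒⊓-threshold C₀ C₁ S D (inj₂ (_ , lt)) = ≤-<-trans (+-monoˡ-≤ S (∸-monoˡ-≤ 1 (m⊓n≤n C₀ C₁))) lt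

+-rotate : ∀ a b c → a + b + c ≡ b + c + a
+-rotate a b c = trans (+-assoc a b c) (+-comm a (b + c))

long-edge : ∀ {K δ S a b c} → 3 * K + 1 ≡ 2 * δ → b ≤ δ → c ≤ δ →
  2 * K + 2 * K + S < a + b + c → S + K ≤ a
long-edge {K} {δ} {S} {a} {b} {c} 2δ≡ b≤δ c≤δ lt =
  s≤s⁻¹ (+-cancelˡ-< (3 * K) (S + K) (suc a) (begin-strict
    3 * K + (S + K)     ≡⟨ lhs-shape K S ⟩
    2 * K + 2 * K + S   <⟨ lt ⟩
    a + b + c           ≡⟨ +-assoc a b c ⟩
    a + (b + c)         ≤⟨ +-monoʳ-≤ a (+-mono-≤ b≤δ (m≤n⇒m≤n+o 0 c≤δ)) ⟩
    a + 2 * δ           ≡⟨ cong (a +_) (sym 2δ≡) ⟩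
    a + (3 * K + 1)     ≡⟨ rhs-shape a K ⟩
    3 * K + suc a       ∎))
  where
  open ≤-Reasoning
  lhs-shape : ∀ K S → 3 * K + (S + K) ≡ 2 * K + 2 * K + S
  lhs-shape = solve-∀
  rhs-shape : ∀ a K → a + (3 * K + 1) ≡ 3 * K + suc a
  rhs-shape = solve-∀

three-long-edges : ∀ {K δ S a b c} → 3 * K + 1 ≡ 2 * δ → a ≤ δ → b ≤ δ → c ≤ δ →
  2 * K + 2 * K + S < a + b + c → S + K ≤ a × S + K ≤ b × S + K ≤ c
three-long-edges {K} {δ} {S} {a} {b} {c} 2δ≡ a≤δ b≤δ c≤δ lt =
    long-edge {K} {δ} {S} 2δ≡ b≤δ c≤δ lt
  , long-edge {K} {δ} {S} 2δ≡ c≤δ a≤δ (subst (4K+S <_) (+-rotate a b c) lt)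
  , long-edge {K} {δ} {S} 2δ≡ a≤δ b≤δ (subst (4K+S <_) (trans (+-rotate a b c) (+-rotate b c a)) lt)
  where
  4K+S = 2 * K + 2 * K + S

2≤K : ∀ {K δ} → 3 ≤ δ → 3 * K + 1 ≡ 2 * δ → 2 ≤ K
2≤K 3≤δ 2δ≡ = 6≤3K+1⇒2≤K (subst (6 ≤_) (sym 2δ≡) (*-monoʳ-≤ 2 3≤δ))
  where
  6≤3K+1⇒2≤K : ∀ {K} → 6 ≤ 3 * K + 1 → 2 ≤ K
  6≤3K+1⇒2≤K {0} (s≤s ())
  6≤3K+1⇒2≤K {1} (s≤s (s≤s (s≤s (s≤s ()))))
  6≤3K+1⇒2≤K {suc (suc K)} _ = s≤s (s≤s z≤n)

δ∸K<K : ∀ {K δ} → 2 ≤ K → 3 * K + 1 ≡ 2 * δ → δ ∸ K < K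
δ∸K<K {K} {δ} 2≤K 2δ≡ = m<n+o⇒m∸n<o δ K {{>-nonZero (<-≤-trans z<s 2≤K)}}
  (*-cancelˡ-< 2 δ (K + K) (begin-strict
    2 * δ          ≡⟨ sym 2δ≡ ⟩
    3 * K + 1      <⟨ +-monoʳ-< (3 * K) 2≤K ⟩
    3 * K + K      ≡⟨ double K ⟩
    2 * (K + K)    ∎))
  where
  open ≤-Reasoning
  double : ∀ K → 3 * K + K ≡ 2 * (K + K)
  double = solve-∀

mainTheorem13 : ∀ {δ K₁ K₂ C₀ C₁ : ℕ} → Admissible δ K₁ K₂ C₀ C₁ → CaseIIB δ K₁ K₂ C₀ C₁ →
    (c : LabelledCycle δ) (d₀ d₁ d₂ : ℕ) (xs : List ℕ) →
    HasDistances c (d₀ ∷ d₁ ∷ d₂ ∷ xs) →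
    ((Even (perimeter c) × d₀ + d₁ + d₂ > (C₀ ∸ 1) + sum xs)
      ⊎ (Odd (perimeter c) × d₀ + d₁ + d₂ > (C₁ ∸ 1) + sum xs)) →
    (K₂ ≤ d₀ × K₂ ≤ d₁ × K₂ ≤ d₂) × (sum xs ≤ δ ∸ K₂ × δ ∸ K₂ < K₁)
mainTheorem13 {δ} {K₁} {K₂} {C₀} {C₁} adm iib c d₀ d₁ d₂ xs p long =
  let (d₀≤δ , d₁≤δ , d₂≤δ) = HasDistances⇒first-three-≤ c p
      (e₀ , e₁ , e₂) = three-long-edges {K₂} {δ} {sum xs} c7 d₀≤δ d₁≤δ d₂≤δ 4K+S<d₀+d₁+d₂
  in
    (m+n≤o⇒n≤o (sum xs) e₀ , m+n≤o⇒n≤o (sum xs) e₁ , m+n≤o⇒n≤o (sum xs) e₂)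
  , m+n≤o⇒m≤o∸n (sum xs) (≤-trans e₀ d₀≤δ)
  , subst (δ ∸ K₂ <_) (sym c6) (δ∸K<K (2≤K δ≥3 c7) c7)
  where
  open Admissible adm
  open CaseIIB iib
  C∸1≡4K : C₀ ⊓ C₁ ∸ 1 ≡ 2 * K₂ + 2 * K₂
  C∸1≡4K = trans (cong (_∸ 1) c2) (trans (m+n∸n≡m _ 1) (cong (λ k → 2 * k + 2 * K₂) c6))
  4K+S<d₀+d₁+d₂ : 2 * K₂ + 2 * K₂ + sum xs < d₀ + d₁ + d₂
  4K+S<d₀+d₁+d₂ = subst (λ t → t + sum xs < d₀ + d₁ + d₂) C∸1≡4K (⊎-threshold⇒⊓-threshold C₀ C₁ (sum xs) _ long)
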